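{- In the ring $\mathbb{Z}[[a,c,q]]$ of formal power series in the variables $a,c,q$, the following identity holds: \[ \frac{\prod_{k=1}^{\infty}(1+acq^{k})}{1-a} +\sum_{n=1}^{\infty} \frac{a\,q^{n}\prod_{k=n+1}^{\infty}(1+acq^{k})}{(1-a)(1-aq)(1-aq^{2}) \cdots (1-aq^{n})} + \sum_{n=1}^{\infty} q^{\binom{n+1}{2}} c^{n}\prod_{k=n+1}^{\infty}(1+acq^{k}) = \left(\sum_{n=0}^{\infty}q^{\binom{n+1}{2}}c^{n}\right) \left(\prod_{k=0}^{\infty} \frac{1}{1-aq^{k}} \right). \] Equivalently, $\prod_{k=1}^{\infty}(1+acq^{k})+\sum_{n=0}^{\infty} \frac{a q^{n}\prod_{k=n+1}^{\infty}(1+acq^{k})}{(1-a)(1-aq)\cdots(1-aq^{n})}+\sum_{n=1}^{\infty} q^{\binom{n+1}{2}} c^{n}\prod_{k=n+1}^{\infty}(1+acq^{k})$ equals the same right-hand side.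
   Context: All series and products are interpreted as formal power series in $a,c,q$; $1/(1-x)$ denotes $\sum_{j\ge0}x^j$. -}

module Defs where

open import Data.Bool using (Bool; true; false; if_then_else_; _∧_)
open import Data.Nat as ℕ using (ℕ; zero; suc; _∸_; _≡ᵇ_)
open import Data.Nat.Combinatorics using (_C_)
open import Data.Integer as ℤ using (ℤ; 0ℤ; 1ℤ)

-- Formal power series in Z[[a,c,q]], given by their coefficients:
-- F i j m is the coefficient of a^i c^j q^m.
FPS : Set
FPS = ℕ → ℕ → ℕ → ℤ

sumℤ : ℕ → (ℕ → ℤ) → ℤ
sumℤ zero    f = 0ℤ
sumℤ (suc n) f = sumℤ n f ℤ.+ f n

0F : FPS
0F _ _ _ = 0ℤ

mono : ℕ → ℕ → ℕ → FPS
mono i j m i' j' m' = if (i ≡ᵇ i') ∧ (j ≡ᵇ j') ∧ (m ≡ᵇ m') then 1ℤ else 0ℤ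

1F : FPS
1F = mono 0 0 0

aF cF qF : FPS
aF = mono 1 0 0
cF = mono 0 1 0
qF = mono 0 0 1

infixl 6 _+F_
infixl 7 _*F_
infixr 8 _^F_

_+F_ : FPS → FPS → FPS
(f +F g) i j m = f i j m ℤ.+ g i j m

_*F_ : FPS → FPS → FPS
(f *F g) i j m =
  sumℤ (suc i) λ i₁ → sumℤ (suc j) λ j₁ → sumℤ (suc m) λ m₁ →
    f i₁ j₁ m₁ ℤ.* g (i ∸ i₁) (j ∸ j₁) (m ∸ m₁)

_^F_ : FPS → ℕ → FPS
f ^F zero  = 1F
f ^F suc n = f ^F n *F f

sumN : ℕ → (ℕ → FPS) → FPS
sumN zero    f = 0F
sumN (suc n) f = sumN n f +F f n

prodN : ℕ → (ℕ → FPS) → FPS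
prodN zero    f = 1F
prodN (suc n) f = prodN n f *F f n

-- Infinite sum Σ_{k≥0} f k and infinite product Π_{k≥0} f k, defined as the
-- (a,c,q)-adic limit of partial sums/products.  For all families used below,
-- f k (resp. f k - 1) has total degree ≥ k, so the coefficient of
-- a^i c^j q^m of the limit equals that of the partial sum/product over
-- k ≤ i + j + m; we define the limit by exactly this stabilised value.
InfSum : (ℕ → FPS) → FPS
InfSum f i j m = sumN (suc (i ℕ.+ j ℕ.+ m)) f i j m

InfProd : (ℕ → FPS) → FPS
InfProd f i j m = prodN (suc (i ℕ.+ j ℕ.+ m)) f i j m

-- 1/(1-x) := Σ_{j≥0} x^j   (x without constant term)
geom : FPS → FPS
geom x = InfSum (λ j → x ^F j)

P : ℕ → FPS
P s = InfProd (λ k → 1F +F aF *F cF *F qF ^F (s ℕ.+ k))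

Den : ℕ → FPS
Den n = prodN (suc n) (λ k → geom (aF *F qF ^F k))

T₁ : ℕ → FPS
T₁ n = aF *F qF ^F n *F P (suc n) *F Den n

T₂ : ℕ → FPS
T₂ n = qF ^F (suc n C 2) *F cF ^F n *F P (suc n)

LHS : FPS
LHS = geom aF *F P 1
   +F InfSum (λ n → T₁ (suc n))
   +F InfSum (λ n → T₂ (suc n))

RHS : FPS
RHS = InfSum (λ n → qF ^F (suc n C 2) *F cF ^F n)
   *F InfProd (λ k → geom (aF *F qF ^F k))

module Submission where

open import Relation.Binary.PropositionalEquality using (_≡_)
open import Data.Nat using (ℕ)
open import Defs

open import Level using (0ℓ)
open import Algebra.Bundles using (CommutativeRing)
open import Data.Nat as ℕ using (zero; suc; _∸_; _<_; _≤_; z≤n; s≤s)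
import Data.Nat.Properties as ℕP
open import Data.Product using (_,_)
open import Data.Sum using (inj₁; inj₂)
open import Data.Bool using (true; false; T)
open import Data.Unit using (tt)
open import Data.Empty using (⊥-elim)
open import Data.Nat.Combinatorics using (_C_)
import Data.Nat.Combinatorics as NC
open import Data.Maybe using (Maybe; just; nothing)
open import Relation.Nullary using (yes; no)
open import Function using (_∘_)
open import Data.Integer as ℤ using (ℤ; +_; -[1+_]; _⊖_)
import Data.Integer.Properties as ℤP
import Relation.Binary.PropositionalEquality as ≡
import Data.Nat.Solver

-- Notation: P s = Π_{k≥s}(1 + acq^k), D (n+1) = 1/((1−a)⋯(1−aq^n)) with
-- D 0 = 1, D∞ = Π_{k≥0} 1/(1−aq^k), Q k = q^(k+1 choose 2) c^k and
-- K s = Σ_{n≥0} a q^n P(s+n) D(n+1).  Since a q^n D(n+1) = D(n+1) − D n and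
-- P t − P(t+1) = acq^t P(t+1), summation by parts gives the recurrence
-- K s = D∞ − P s + cq^s K(s+1); unrolling it, K 1 = Σ_k Q k (D∞ − P(k+1)).
-- The left-hand side is K 1 + Σ_k Q k P(k+1) (its first term splits as
-- P 1 + aP 1/(1−a)), hence equals (Σ_k Q k) D∞, the right-hand side.
--
-- The infinite sums and products of Defs are defined by truncation, so the
-- argument runs in the ring Trunc d of series modulo total degree d.

-- Integer (rather than natural)
-- coefficients are needed so that identities involving subtraction are
-- normalised by cancellation.
module IntegerSolver (R : CommutativeRing 0ℓ 0ℓ) where
  open CommutativeRing R
  open import Relation.Binary.Reasoning.Setoid setoid
  open import Algebra.Properties.Semiring.Mult.TCOptimised semiring using (_×_; 1+×; ×-homo-+; ×1-homo-*)
  open import Algebra.Properties.Ring ring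
    using (-‿distribˡ-*; -‿distribʳ-*; -0#≈0#; -‿involutive; -‿+-comm)
  import Algebra.Solver.Ring.AlmostCommutativeRing as ACR
  open import Data.Sign as Sign using (Sign)

  ⟦_⟧ᶻ : ℤ → Carrier
  ⟦ + n ⟧ᶻ     = n × 1#
  ⟦ -[1+ n ] ⟧ᶻ = - (suc n × 1#)

  private
    cancelˡ : ∀ x y z → (x + y) + - (x + z) ≈ y + - z
    cancelˡ x y z = begin
      (x + y) + - (x + z)    ≈⟨ +-congˡ (sym (-‿+-comm x z)) ⟩
      (x + y) + (- x + - z)  ≈⟨ +-assoc x y _ ⟩
      x + (y + (- x + - z))  ≈⟨ +-congˡ (sym (+-assoc y (- x) (- z))) ⟩
      x + ((y + - x) + - z)  ≈⟨ +-congˡ (+-congʳ (+-comm y (- x))) ⟩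
      x + ((- x + y) + - z)  ≈⟨ +-congˡ (+-assoc (- x) y (- z)) ⟩
      x + (- x + (y + - z))  ≈⟨ sym (+-assoc x (- x) _) ⟩
      (x + - x) + (y + - z)  ≈⟨ +-congʳ (-‿inverseʳ x) ⟩
      0# + (y + - z)         ≈⟨ +-identityˡ _ ⟩
      y + - z                ∎

    ⊖-homo : ∀ m n → ⟦ m ⊖ n ⟧ᶻ ≈ m × 1# + - (n × 1#)
    ⊖-homo m zero = begin
      ⟦ m ⊖ 0 ⟧ᶻ         ≡⟨ ≡.cong ⟦_⟧ᶻ (ℤP.⊖-≥ {m} {0} z≤n) ⟩
      m × 1#             ≈⟨ sym (+-identityʳ _) ⟩
      m × 1# + 0#        ≈⟨ +-congˡ (sym -0#≈0#) ⟩
      m × 1# + - 0#      ∎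
    ⊖-homo zero (suc n) = begin
      ⟦ 0 ⊖ suc n ⟧ᶻ     ≡⟨ ≡.cong ⟦_⟧ᶻ (ℤP.⊖-≤ {0} {suc n} z≤n) ⟩
      - (suc n × 1#)     ≈⟨ sym (+-identityˡ _) ⟩
      0# + - (suc n × 1#) ∎
    ⊖-homo (suc m) (suc n) = begin
      ⟦ suc m ⊖ suc n ⟧ᶻ                       ≡⟨ ≡.cong ⟦_⟧ᶻ (ℤP.[1+m]⊖[1+n]≡m⊖n m n) ⟩
      ⟦ m ⊖ n ⟧ᶻ                               ≈⟨ ⊖-homo m n ⟩
      m × 1# + - (n × 1#)                      ≈⟨ sym (cancelˡ 1# (m × 1#) (n × 1#)) ⟩
      (1# + m × 1#) + - (1# + n × 1#)          ≈⟨ sym (+-cong (1+× m 1#) (-‿cong (1+× n 1#))) ⟩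
      suc m × 1# + - (suc n × 1#)              ∎

    +-homo : ∀ i j → ⟦ i ℤ.+ j ⟧ᶻ ≈ ⟦ i ⟧ᶻ + ⟦ j ⟧ᶻ
    +-homo -[1+ m ] -[1+ n ] = begin
      - (suc (suc (m ℕ.+ n)) × 1#)        ≡⟨ ≡.cong (λ k → - (suc k × 1#)) (≡.sym (ℕP.+-suc m n)) ⟩
      - ((suc m ℕ.+ suc n) × 1#)          ≈⟨ -‿cong (×-homo-+ 1# (suc m) (suc n)) ⟩
      - (suc m × 1# + suc n × 1#)         ≈⟨ sym (-‿+-comm _ _) ⟩
      - (suc m × 1#) + - (suc n × 1#)     ∎
    +-homo -[1+ m ] (+ n) = trans (⊖-homo n (suc m)) (+-comm _ _)
    +-homo (+ m) -[1+ n ] = ⊖-homo m (suc n)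
    +-homo (+ m) (+ n)    = ×-homo-+ 1# m n

    neg-homo : ∀ i → ⟦ ℤ.- i ⟧ᶻ ≈ - ⟦ i ⟧ᶻ
    neg-homo (+ zero)  = sym -0#≈0#
    neg-homo (+ suc n) = refl
    neg-homo -[1+ n ]  = sym (-‿involutive _)

    +◃-homo : ∀ k → ⟦ Sign.+ ℤ.◃ k ⟧ᶻ ≈ k × 1#
    +◃-homo zero    = refl
    +◃-homo (suc k) = refl

    -◃-homo : ∀ k → ⟦ Sign.- ℤ.◃ k ⟧ᶻ ≈ - (k × 1#)
    -◃-homo zero    = sym -0#≈0#
    -◃-homo (suc k) = refl

    *-homo : ∀ i j → ⟦ i ℤ.* j ⟧ᶻ ≈ ⟦ i ⟧ᶻ * ⟦ j ⟧ᶻ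
    *-homo (+ m) (+ n) = trans (+◃-homo (m ℕ.* n)) (×1-homo-* m n)
    *-homo (+ m) -[1+ n ] = begin
      ⟦ Sign.- ℤ.◃ (m ℕ.* suc n) ⟧ᶻ  ≈⟨ -◃-homo (m ℕ.* suc n) ⟩
      - ((m ℕ.* suc n) × 1#)         ≈⟨ -‿cong (×1-homo-* m (suc n)) ⟩
      - (m × 1# * suc n × 1#)        ≈⟨ -‿distribʳ-* _ _ ⟩
      m × 1# * - (suc n × 1#)        ∎
    *-homo -[1+ m ] (+ n) = begin
      ⟦ Sign.- ℤ.◃ (suc m ℕ.* n) ⟧ᶻ  ≈⟨ -◃-homo (suc m ℕ.* n) ⟩
      - ((suc m ℕ.* n) × 1#)         ≈⟨ -‿cong (×1-homo-* (suc m) n) ⟩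
      - (suc m × 1# * n × 1#)        ≈⟨ -‿distribˡ-* _ _ ⟩
      - (suc m × 1#) * n × 1#        ∎
    *-homo -[1+ m ] -[1+ n ] = begin
      ⟦ Sign.+ ℤ.◃ (suc m ℕ.* suc n) ⟧ᶻ     ≈⟨ +◃-homo (suc m ℕ.* suc n) ⟩
      (suc m ℕ.* suc n) × 1#                ≈⟨ ×1-homo-* (suc m) (suc n) ⟩
      x * y                                 ≈⟨ sym (-‿involutive _) ⟩
      - - (x * y)                           ≈⟨ -‿cong (-‿distribʳ-* x y) ⟩
      - (x * - y)                           ≈⟨ -‿distribˡ-* x (- y) ⟩
      - x * - y                             ∎
      where x = suc m × 1#; y = suc n × 1#

  morphism : ℤ.+-*-rawRing ACR.-Raw-AlmostCommutative⟶ ACR.fromCommutativeRing R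
  morphism = record
    { ⟦_⟧ = ⟦_⟧ᶻ ; +-homo = +-homo ; *-homo = *-homo ; -‿homo = neg-homo
    ; 0-homo = refl ; 1-homo = refl }

  coefficients≟ : ∀ i j → Maybe (⟦ i ⟧ᶻ ≈ ⟦ j ⟧ᶻ)
  coefficients≟ i j with i ℤ.≟ j
  ... | yes i≡j = just (reflexive (≡.cong ⟦_⟧ᶻ i≡j))
  ... | no _    = nothing

  open import Algebra.Solver.Ring ℤ.+-*-rawRing (ACR.fromCommutativeRing R) morphism coefficients≟ public

module FiniteSums (R : CommutativeRing 0ℓ 0ℓ) where
  open CommutativeRing R
  open import Relation.Binary.Reasoning.Setoid setoid
  open IntegerSolver R using (solve; _:=_; _:+_)

  sumR : ℕ → (ℕ → Carrier) → Carrier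
  sumR zero    f = 0#
  sumR (suc n) f = sumR n f + f n

  sum-congᵇ : ∀ n {f g : ℕ → Carrier} → (∀ k → k < n → f k ≈ g k) → sumR n f ≈ sumR n g
  sum-congᵇ zero    f≈g = refl
  sum-congᵇ (suc n) f≈g = +-cong (sum-congᵇ n (λ k k<n → f≈g k (ℕP.m<n⇒m<1+n k<n))) (f≈g n ℕP.≤-refl)

  sum-cong : ∀ n {f g : ℕ → Carrier} → (∀ k → f k ≈ g k) → sumR n f ≈ sumR n g
  sum-cong n f≈g = sum-congᵇ n (λ k _ → f≈g k)

  sum-+ : ∀ n (f g : ℕ → Carrier) → sumR n (λ k → f k + g k) ≈ sumR n f + sumR n g
  sum-+ zero    f g = sym (+-identityʳ 0#)
  sum-+ (suc n) f g = begin
    sumR n (λ k → f k + g k) + (f n + g n)  ≈⟨ +-congʳ (sum-+ n f g) ⟩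
    (sumR n f + sumR n g) + (f n + g n)     ≈⟨ solve 4 (λ a b c d → (a :+ b) :+ (c :+ d) := (a :+ c) :+ (b :+ d))
                                                 refl (sumR n f) (sumR n g) (f n) (g n) ⟩
    (sumR n f + f n) + (sumR n g + g n)     ∎

  sum-*ˡ : ∀ n x (f : ℕ → Carrier) → sumR n (λ k → x * f k) ≈ x * sumR n f
  sum-*ˡ zero    x f = sym (zeroʳ x)
  sum-*ˡ (suc n) x f = trans (+-congʳ (sum-*ˡ n x f)) (sym (distribˡ x (sumR n f) (f n)))

  sum-peel : ∀ n (f : ℕ → Carrier) → sumR (suc n) f ≈ f 0 + sumR n (f ∘ suc)
  sum-peel zero    f = trans (+-identityˡ (f 0)) (sym (+-identityʳ (f 0)))
  sum-peel (suc n) f = trans (+-congʳ (sum-peel n f)) (+-assoc (f 0) _ _)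

  sum-reverse : ∀ n (f : ℕ → Carrier) → sumR (suc n) f ≈ sumR (suc n) (λ k → f (n ∸ k))
  sum-reverse zero    f = refl
  sum-reverse (suc n) f = begin
    sumR (suc n) f + f (suc n)                   ≈⟨ +-comm _ _ ⟩
    f (suc n) + sumR (suc n) f                   ≈⟨ +-congˡ (sum-reverse n f) ⟩
    f (suc n) + sumR (suc n) (λ k → f (n ∸ k))   ≈⟨ sym (sum-peel (suc n) (λ k → f (suc n ∸ k))) ⟩
    sumR (suc (suc n)) (λ k → f (suc n ∸ k))     ∎

-- Iterating this three times gives the ring laws for series in a, c, q.
module PowerSeries (R : CommutativeRing 0ℓ 0ℓ) where
  open CommutativeRing R
  open import Relation.Binary.Reasoning.Setoid setoid
  open IntegerSolver R using (solve; _:=_; _:+_; _:*_)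
  open FiniteSums R

  Series : Set
  Series = ℕ → Carrier

  _≋_ : Series → Series → Set
  f ≋ g = ∀ n → f n ≈ g n

  one : Series
  one zero    = 1#
  one (suc n) = 0#

  _⋆_ : Series → Series → Series
  (f ⋆ g) n = sumR (suc n) (λ k → f k * g (n ∸ k))

  ⋆-zero : ∀ f g → (f ⋆ g) 0 ≈ f 0 * g 0
  ⋆-zero f g = +-identityˡ _

  ⋆-suc : ∀ f g n → (f ⋆ g) (suc n) ≈ f 0 * g (suc n) + ((f ∘ suc) ⋆ g) n
  ⋆-suc f g n = sum-peel (suc n) (λ k → f k * g (suc n ∸ k))

  ⋆-cong : ∀ {f f′ g g′} → f ≋ f′ → g ≋ g′ → (f ⋆ g) ≋ (f′ ⋆ g′)
  ⋆-cong f≋f′ g≋g′ n = sum-cong (suc n) (λ k → *-cong (f≋f′ k) (g≋g′ (n ∸ k)))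

  ⋆-comm : ∀ f g → (f ⋆ g) ≋ (g ⋆ f)
  ⋆-comm f g n = trans (sum-reverse n _) (sum-congᵇ (suc n) λ k k≤n →
    trans (*-congˡ (reflexive (≡.cong g (ℕP.m∸[m∸n]≡n (ℕP.≤-pred k≤n))))) (*-comm _ _))

  ⋆-distribʳ : ∀ h f g → ((λ n → f n + g n) ⋆ h) ≋ (λ n → (f ⋆ h) n + (g ⋆ h) n)
  ⋆-distribʳ h f g n = trans (sum-cong (suc n) (λ k → distribʳ _ _ _)) (sum-+ (suc n) _ _)

  ⋆-identityˡ : ∀ f → (one ⋆ f) ≋ f
  ⋆-identityˡ f zero    = trans (⋆-zero one f) (*-identityˡ _)
  ⋆-identityˡ f (suc n) = begin
    (one ⋆ f) (suc n)                         ≈⟨ ⋆-suc one f n ⟩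
    1# * f (suc n) + sumR (suc n) (λ k → 0# * f (n ∸ k))
                                              ≈⟨ +-cong (*-identityˡ _) (sum-*ˡ (suc n) 0# (λ k → f (n ∸ k))) ⟩
    f (suc n) + 0# * sumR (suc n) (λ k → f (n ∸ k))
                                              ≈⟨ +-congˡ (zeroˡ _) ⟩
    f (suc n) + 0#                            ≈⟨ +-identityʳ _ ⟩
    f (suc n)                                 ∎

  ⋆-scalarˡ : ∀ x f h n → ((λ m → x * f m) ⋆ h) n ≈ x * (f ⋆ h) n
  ⋆-scalarˡ x f h n = trans (sum-cong (suc n) (λ k → *-assoc _ _ _)) (sum-*ˡ (suc n) x _)

  ⋆-assoc : ∀ f g h n → ((f ⋆ g) ⋆ h) n ≈ (f ⋆ (g ⋆ h)) n
  ⋆-assoc f g h zero = begin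
    ((f ⋆ g) ⋆ h) 0        ≈⟨ trans (⋆-zero (f ⋆ g) h) (*-congʳ (⋆-zero f g)) ⟩
    (f 0 * g 0) * h 0      ≈⟨ *-assoc _ _ _ ⟩
    f 0 * (g 0 * h 0)      ≈⟨ sym (trans (⋆-zero f (g ⋆ h)) (*-congˡ (⋆-zero g h))) ⟩
    (f ⋆ (g ⋆ h)) 0        ∎
  ⋆-assoc f g h (suc n) = begin
    ((f ⋆ g) ⋆ h) (suc n)
      ≈⟨ ⋆-suc (f ⋆ g) h n ⟩
    (f ⋆ g) 0 * h (suc n) + (((f ⋆ g) ∘ suc) ⋆ h) n
      ≈⟨ +-cong (*-congʳ (⋆-zero f g))
           (trans (⋆-cong {g = h} (⋆-suc f g) (λ _ → refl) n)
           (trans (⋆-distribʳ h (λ m → f 0 * g (suc m)) ((f ∘ suc) ⋆ g) n)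
                  (+-cong (⋆-scalarˡ (f 0) (g ∘ suc) h n) (⋆-assoc (f ∘ suc) g h n)))) ⟩
    (f 0 * g 0) * h (suc n) + (f 0 * ((g ∘ suc) ⋆ h) n + ((f ∘ suc) ⋆ (g ⋆ h)) n)
      ≈⟨ solve 5 (λ a b c d e → (a :* b) :* c :+ (a :* d :+ e) := a :* (b :* c :+ d) :+ e)
           refl (f 0) (g 0) (h (suc n)) (((g ∘ suc) ⋆ h) n) (((f ∘ suc) ⋆ (g ⋆ h)) n) ⟩
    f 0 * (g 0 * h (suc n) + ((g ∘ suc) ⋆ h) n) + ((f ∘ suc) ⋆ (g ⋆ h)) n
      ≈⟨ +-congʳ (*-congˡ (sym (⋆-suc g h n))) ⟩
    f 0 * (g ⋆ h) (suc n) + ((f ∘ suc) ⋆ (g ⋆ h)) n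
      ≈⟨ sym (⋆-suc f (g ⋆ h) n) ⟩
    (f ⋆ (g ⋆ h)) (suc n) ∎

  seriesRing : CommutativeRing 0ℓ 0ℓ
  seriesRing = record
    { Carrier = Series ; _≈_ = _≋_ ; _+_ = λ f g n → f n + g n ; _*_ = _⋆_
    ; -_ = λ f n → - f n ; 0# = λ _ → 0# ; 1# = one
    ; isCommutativeRing = record
      { isRing = record
        { +-isAbelianGroup = record
          { isGroup = record
            { isMonoid = record
              { isSemigroup = record
                { isMagma = record
                  { isEquivalence = record
                    { refl = λ n → refl ; sym = λ p n → sym (p n) ; trans = λ p q n → trans (p n) (q n) }
                  ; ∙-cong = λ p q n → +-cong (p n) (q n) }
                ; assoc = λ f g h n → +-assoc (f n) (g n) (h n) }
              ; identity = (λ f n → +-identityˡ (f n)) , (λ f n → +-identityʳ (f n)) }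
            ; inverse = (λ f n → -‿inverseˡ (f n)) , (λ f n → -‿inverseʳ (f n))
            ; ⁻¹-cong = λ p n → -‿cong (p n) }
          ; comm = λ f g n → +-comm (f n) (g n) }
        ; *-cong = ⋆-cong
        ; *-assoc = ⋆-assoc
        ; *-identity = ⋆-identityˡ , (λ f n → trans (⋆-comm f one n) (⋆-identityˡ f n))
        ; distrib = (λ h f g n → trans (⋆-comm h _ n) (trans (⋆-distribʳ h f g n)
                                   (+-cong (⋆-comm f h n) (⋆-comm g h n))))
                  , ⋆-distribʳ }
      ; *-comm = ⋆-comm } }

module Telescoping (R : CommutativeRing 0ℓ 0ℓ) where
  open CommutativeRing R
  open IntegerSolver R using (solve; _:=_; _:+_; _:*_; _:-_; con)
  open FiniteSums R
  open import Relation.Binary.Reasoning.Setoid setoid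

  summation-by-parts : ∀ L (D Y : ℕ → Carrier) →
    sumR L (λ n → (D (suc n) - D n) * Y n) ≈
    (D L * Y L - D 0 * Y 0) + sumR L (λ n → D (suc n) * (Y n - Y (suc n)))
  summation-by-parts zero    D Y = solve 2 (λ d y → con (+ 0) := (d :* y :- d :* y) :+ con (+ 0)) refl (D 0) (Y 0)
  summation-by-parts (suc L) D Y = begin
    sumR L (λ n → (D (suc n) - D n) * Y n) + (D (suc L) - D L) * Y L
      ≈⟨ +-congʳ (summation-by-parts L D Y) ⟩
    (D L * Y L - D 0 * Y 0) + Σ + (D (suc L) - D L) * Y L
      ≈⟨ solve 7 (λ d d′ y y′ d₀ y₀ σ →
                    (d :* y :- d₀ :* y₀) :+ σ :+ (d′ :- d) :* y := (d′ :* y′ :- d₀ :* y₀) :+ (σ :+ d′ :* (y :- y′)))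
           refl (D L) (D (suc L)) (Y L) (Y (suc L)) (D 0) (Y 0) Σ ⟩
    (D (suc L) * Y (suc L) - D 0 * Y 0) + (Σ + D (suc L) * (Y L - Y (suc L))) ∎
    where Σ = sumR L (λ n → D (suc n) * (Y n - Y (suc n)))

  weight : (ℕ → Carrier) → ℕ → ℕ → Carrier
  weight u zero    s = 1#
  weight u (suc k) s = u s * weight u k (suc s)

  unroll : ∀ (K A u : ℕ → Carrier) → (∀ s → K s ≈ A s + u s * K (suc s)) →
    ∀ M s → K s ≈ sumR M (λ k → weight u k s * A (s ℕ.+ k)) + weight u M s * K (s ℕ.+ M)
  unroll K A u rec zero s = begin
    K s                       ≈⟨ solve 1 (λ x → x := con (+ 0) :+ con (+ 1) :* x) refl (K s) ⟩
    0# + 1# * K s             ≡⟨ ≡.cong (λ t → 0# + 1# * K t) (≡.sym (ℕP.+-identityʳ s)) ⟩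
    0# + 1# * K (s ℕ.+ 0)     ∎
  unroll K A u rec (suc M) s = begin
    K s
      ≈⟨ rec s ⟩
    A s + u s * K (suc s)
      ≈⟨ +-congˡ (*-congˡ (unroll K A u rec M (suc s))) ⟩
    A s + u s * (Σ′ + W * K (suc s ℕ.+ M))
      ≈⟨ solve 5 (λ a u σ w k → a :+ u :* (σ :+ w :* k) := con (+ 1) :* a :+ u :* σ :+ (u :* w) :* k)
           refl (A s) (u s) Σ′ W (K (suc s ℕ.+ M)) ⟩
    1# * A s + u s * Σ′ + (u s * W) * K (suc s ℕ.+ M)
      ≈⟨ +-cong (+-cong (*-congˡ (reflexive (≡.cong A (≡.sym (ℕP.+-identityʳ s))))) (sym shift))
                (*-congˡ (reflexive (≡.cong K (≡.sym (ℕP.+-suc s M))))) ⟩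
    F 0 + sumR M (F ∘ suc) + weight u (suc M) s * K (s ℕ.+ suc M)
      ≈⟨ +-congʳ (sym (sum-peel M F)) ⟩
    sumR (suc M) F + weight u (suc M) s * K (s ℕ.+ suc M) ∎
    where
    F : ℕ → Carrier
    F k = weight u k s * A (s ℕ.+ k)
    Σ′ = sumR M (λ k → weight u k (suc s) * A (suc s ℕ.+ k))
    W  = weight u M (suc s)
    shift : sumR M (F ∘ suc) ≈ u s * Σ′
    shift = trans (sum-cong M (λ k → trans (*-congˡ (reflexive (≡.cong A (ℕP.+-suc s k)))) (*-assoc _ _ _)))
                  (sum-*ˡ M (u s) (λ k → weight u k (suc s) * A (suc s ℕ.+ k)))

  -- Let P s play the role of
  -- Π_{k≥s}(1 + a c q^k) and D (n+1) that of 1/((1−a)⋯(1−aq^n)), through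
  -- the two relations P-step and D-step.
  module Recurrence
    (a c : Carrier) (qp P D : ℕ → Carrier)
    (qp-+  : ∀ m n → qp (m ℕ.+ n) ≈ qp m * qp n)
    (P-step : ∀ t → P t ≈ P (suc t) + a * c * qp t * P (suc t))
    (D-step : ∀ n → a * qp n * D (suc n) ≈ D (suc n) - D n)
    where

    term : ℕ → ℕ → Carrier
    term s n = a * qp n * P (s ℕ.+ n) * D (suc n)

    K : ℕ → ℕ → Carrier
    K L s = sumR L (term s)

    A : ℕ → ℕ → Carrier
    A L s = D L * P (s ℕ.+ L) - D 0 * P s

    u : ℕ → Carrier
    u s = c * qp s

    term-as-difference : ∀ s n → term s n ≈ (D (suc n) - D n) * P (s ℕ.+ n)
    term-as-difference s n = begin
      a * qp n * P (s ℕ.+ n) * D (suc n)    ≈⟨ solve 4 (λ a q p d → a :* q :* p :* d := (a :* q :* d) :* p)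
                                                  refl a (qp n) (P (s ℕ.+ n)) (D (suc n)) ⟩
      (a * qp n * D (suc n)) * P (s ℕ.+ n)  ≈⟨ *-congʳ (D-step n) ⟩
      (D (suc n) - D n) * P (s ℕ.+ n)       ∎

    difference-as-term : ∀ s n → D (suc n) * (P (s ℕ.+ n) - P (s ℕ.+ suc n)) ≈ u s * term (suc s) n
    difference-as-term s n = begin
      D (suc n) * (P (s ℕ.+ n) - P (s ℕ.+ suc n))
        ≈⟨ *-congˡ (+-cong (P-step (s ℕ.+ n)) (-‿cong (reflexive (≡.cong P (ℕP.+-suc s n))))) ⟩
      D (suc n) * ((P′ + a * c * qp (s ℕ.+ n) * P′) - P′)
        ≈⟨ *-congˡ (+-congʳ (+-congˡ (*-congʳ (*-congˡ (qp-+ s n))))) ⟩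
      D (suc n) * ((P′ + a * c * (qp s * qp n) * P′) - P′)
        ≈⟨ solve 6 (λ d p a c q q′ → d :* ((p :+ a :* c :* (q :* q′) :* p) :- p) := (c :* q) :* (a :* q′ :* p :* d))
             refl (D (suc n)) P′ a c (qp s) (qp n) ⟩
      u s * term (suc s) n ∎
      where P′ = P (suc s ℕ.+ n)

    K-recurrence : ∀ L s → K L s ≈ A L s + u s * K L (suc s)
    K-recurrence L s = begin
      K L s
        ≈⟨ sum-cong L (term-as-difference s) ⟩
      sumR L (λ n → (D (suc n) - D n) * P (s ℕ.+ n))
        ≈⟨ summation-by-parts L D (λ n → P (s ℕ.+ n)) ⟩
      (D L * P (s ℕ.+ L) - D 0 * P (s ℕ.+ 0)) + sumR L (λ n → D (suc n) * (P (s ℕ.+ n) - P (s ℕ.+ suc n)))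
        ≈⟨ +-cong (+-congˡ (-‿cong (*-congˡ (reflexive (≡.cong P (ℕP.+-identityʳ s))))))
                  (sum-cong L (difference-as-term s)) ⟩
      A L s + sumR L (λ n → u s * term (suc s) n)
        ≈⟨ +-congˡ (sum-*ˡ L (u s) (term (suc s))) ⟩
      A L s + u s * K L (suc s) ∎

    K-unrolled : ∀ L M s → K L s ≈ sumR M (λ k → weight u k s * A L (s ℕ.+ k)) + weight u M s * K L (s ℕ.+ M)
    K-unrolled L = unroll (K L) (A L) u (K-recurrence L)

-- The rings ℤ[[q]], ℤ[[c,q]], ℤ[[a,c,q]]; the carrier of the last one is FPS.
ℤ-ring ℤ[[q]] ℤ[[c,q]] ℤ[[a,c,q]] : CommutativeRing 0ℓ 0ℓ
ℤ-ring      = ℤP.+-*-commutativeRing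
ℤ[[q]]      = PowerSeries.seriesRing ℤ-ring
ℤ[[c,q]]    = PowerSeries.seriesRing ℤ[[q]]
ℤ[[a,c,q]]  = PowerSeries.seriesRing ℤ[[c,q]]

module Trivariate = CommutativeRing ℤ[[a,c,q]]

_≐_ : FPS → FPS → Set
f ≐ g = ∀ i j m → f i j m ≡ g i j m

sumℤ-congᵇ : ∀ n {f g : ℕ → ℤ} → (∀ k → k < n → f k ≡ g k) → sumℤ n f ≡ sumℤ n g
sumℤ-congᵇ zero    f≡g = ≡.refl
sumℤ-congᵇ (suc n) f≡g =
  ≡.cong₂ ℤ._+_ (sumℤ-congᵇ n (λ k k<n → f≡g k (ℕP.m<n⇒m<1+n k<n))) (f≡g n ℕP.≤-refl)

sumℤ-zeroᵇ : ∀ n {f : ℕ → ℤ} → (∀ k → k < n → f k ≡ ℤ.0ℤ) → sumℤ n f ≡ ℤ.0ℤ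
sumℤ-zeroᵇ zero    f≡0 = ≡.refl
sumℤ-zeroᵇ (suc n) f≡0 =
  ≡.cong₂ ℤ._+_ (sumℤ-zeroᵇ n (λ k k<n → f≡0 k (ℕP.m<n⇒m<1+n k<n))) (f≡0 n ℕP.≤-refl)

private
  sumℤ≡sumR : ∀ n f → sumℤ n f ≡ FiniteSums.sumR ℤ-ring n f
  sumℤ≡sumR zero    f = ≡.refl
  sumℤ≡sumR (suc n) f = ≡.cong (ℤ._+ f n) (sumℤ≡sumR n f)

  sumR-coeff : (R : CommutativeRing 0ℓ 0ℓ) → ∀ n F j →
    FiniteSums.sumR (PowerSeries.seriesRing R) n F j ≡ FiniteSums.sumR R n (λ k → F k j)
  sumR-coeff R zero    F j = ≡.refl
  sumR-coeff R (suc n) F j = ≡.cong (λ z → CommutativeRing._+_ R z (F n j)) (sumR-coeff R n F j)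

  sumR-cong≡ : (R : CommutativeRing 0ℓ 0ℓ) → ∀ n {f g} → (∀ k → f k ≡ g k) →
    FiniteSums.sumR R n f ≡ FiniteSums.sumR R n g
  sumR-cong≡ R zero    f≡g = ≡.refl
  sumR-cong≡ R (suc n) f≡g = ≡.cong₂ (CommutativeRing._+_ R) (sumR-cong≡ R n f≡g) (f≡g n)

private
  _⋆_ : FPS → FPS → FPS
  _⋆_ = Trivariate._*_

  ≐-refl : ∀ {f} → f ≐ f
  ≐-refl _ _ _ = ≡.refl

  ≐-sym : ∀ {f g} → f ≐ g → g ≐ f
  ≐-sym p i j m = ≡.sym (p i j m)

  ≐-trans : ∀ {f g h} → f ≐ g → g ≐ h → f ≐ h
  ≐-trans p q i j m = ≡.trans (p i j m) (q i j m)

-- The product _*F_ of Defs is the product of ℤ[[a,c,q]] and 1F is its unit;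
-- hence _*F_ inherits the commutative-ring laws.
*F≐⋆ : ∀ f g → (f *F g) ≐ (f ⋆ g)
*F≐⋆ f g i j m = ≡.trans unfold-*F (≡.sym unfold-⋆)
  where
  unfold-*F = ≡.trans
    (sumℤ-congᵇ (suc i) (λ i₁ _ → ≡.trans
       (sumℤ-congᵇ (suc j) (λ j₁ _ → sumℤ≡sumR (suc m) _)) (sumℤ≡sumR (suc j) _)))
    (sumℤ≡sumR (suc i) _)
  unfold-⋆ = ≡.trans (≡.cong (λ z → z m) (sumR-coeff ℤ[[q]] (suc i) _ j))
    (≡.trans (sumR-coeff ℤ-ring (suc i) _ m)
             (sumR-cong≡ ℤ-ring (suc i) (λ i₁ → sumR-coeff ℤ-ring (suc j) _ m)))

1F≐one : 1F ≐ Trivariate.1#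
1F≐one zero    zero    zero    = ≡.refl
1F≐one zero    zero    (suc m) = ≡.refl
1F≐one zero    (suc j) m       = ≡.refl
1F≐one (suc i) j       m       = ≡.refl


*F-assoc : ∀ f g h → ((f *F g) *F h) ≐ (f *F (g *F h))
*F-assoc f g h =
  ≐-trans (*F≐⋆ (f *F g) h)
  (≐-trans (Trivariate.*-cong {f *F g} {f ⋆ g} {h} {h} (*F≐⋆ f g) ≐-refl)
  (≐-trans (Trivariate.*-assoc f g h)
  (≐-trans (Trivariate.*-cong {f} {f} {g ⋆ h} {g *F h} ≐-refl (≐-sym (*F≐⋆ g h)))
  (≐-sym (*F≐⋆ f (g *F h))))))

*F-comm : ∀ f g → (f *F g) ≐ (g *F f)
*F-comm f g = ≐-trans (*F≐⋆ f g) (≐-trans (Trivariate.*-comm f g) (≐-sym (*F≐⋆ g f)))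

*F-identityˡ : ∀ f → (1F *F f) ≐ f
*F-identityˡ f = ≐-trans (*F≐⋆ 1F f)
  (≐-trans (Trivariate.*-cong {1F} {Trivariate.1#} {f} {f} 1F≐one ≐-refl) (Trivariate.*-identityˡ f))

*F-distribˡ : ∀ f g h → (f *F (g +F h)) ≐ ((f *F g) +F (f *F h))
*F-distribˡ f g h = ≐-trans (*F≐⋆ f (g +F h))
  (≐-trans (Trivariate.distribˡ f g h)
           (Trivariate.+-cong {f ⋆ g} {f *F g} {f ⋆ h} {f *F h} (≐-sym (*F≐⋆ f g)) (≐-sym (*F≐⋆ f h))))

-- Each ≃[ d ] is a congruence for the ring operations, so series modulo
-- degree d form a commutative ring; all reasoning below happens there.
infix 4 _≃[_]_
record _≃[_]_ (f : FPS) (d : ℕ) (g : FPS) : Set where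
  constructor agree
  field coeff : ∀ i j m → i ℕ.+ j ℕ.+ m < d → f i j m ≡ g i j m
open _≃[_]_ public

Ord : ℕ → FPS → Set
Ord d f = f ≃[ d ] 0F

exact : ∀ {d f g} → f ≐ g → f ≃[ d ] g
exact f≐g = agree (λ i j m _ → f≐g i j m)

≃-refl : ∀ {d f} → f ≃[ d ] f
≃-refl = agree (λ _ _ _ _ → ≡.refl)

≃-sym : ∀ {d f g} → f ≃[ d ] g → g ≃[ d ] f
≃-sym f≃g = agree (λ i j m l → ≡.sym (coeff f≃g i j m l))

≃-trans : ∀ {d f g h} → f ≃[ d ] g → g ≃[ d ] h → f ≃[ d ] h
≃-trans f≃g g≃h = agree (λ i j m l → ≡.trans (coeff f≃g i j m l) (coeff g≃h i j m l))

≃-weaken : ∀ {d d′ f g} → d′ ≤ d → f ≃[ d ] g → f ≃[ d′ ] g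
≃-weaken d′≤d f≃g = agree (λ i j m l → coeff f≃g i j m (ℕP.<-≤-trans l d′≤d))

ord-zero : ∀ {f} → Ord 0 f
ord-zero = agree (λ _ _ _ ())

boxSum : ℕ → ℕ → ℕ → (ℕ → ℕ → ℕ → ℤ) → ℤ
boxSum i j m F = sumℤ (suc i) λ i₁ → sumℤ (suc j) λ j₁ → sumℤ (suc m) λ m₁ → F i₁ j₁ m₁

boxSum-cong : ∀ i j m {F G : ℕ → ℕ → ℕ → ℤ} →
  (∀ i₁ j₁ m₁ → i₁ ≤ i → j₁ ≤ j → m₁ ≤ m → F i₁ j₁ m₁ ≡ G i₁ j₁ m₁) →
  boxSum i j m F ≡ boxSum i j m G
boxSum-cong i j m F≡G = sumℤ-congᵇ _ (λ i₁ p → sumℤ-congᵇ _ (λ j₁ q → sumℤ-congᵇ _ (λ m₁ r →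
  F≡G i₁ j₁ m₁ (ℕP.≤-pred p) (ℕP.≤-pred q) (ℕP.≤-pred r))))

boxSum-zero : ∀ i j m {F : ℕ → ℕ → ℕ → ℤ} →
  (∀ i₁ j₁ m₁ → i₁ ≤ i → j₁ ≤ j → m₁ ≤ m → F i₁ j₁ m₁ ≡ ℤ.0ℤ) → boxSum i j m F ≡ ℤ.0ℤ
boxSum-zero i j m F≡0 = sumℤ-zeroᵇ _ (λ i₁ p → sumℤ-zeroᵇ _ (λ j₁ q → sumℤ-zeroᵇ _ (λ m₁ r →
  F≡0 i₁ j₁ m₁ (ℕP.≤-pred p) (ℕP.≤-pred q) (ℕP.≤-pred r))))

module _ {i j m i₁ j₁ m₁ : ℕ} where
  private module NS = Data.Nat.Solver.+-*-Solver

  degree-≤ : i₁ ≤ i → j₁ ≤ j → m₁ ≤ m → i₁ ℕ.+ j₁ ℕ.+ m₁ ≤ i ℕ.+ j ℕ.+ m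
  degree-≤ p q r = ℕP.+-mono-≤ (ℕP.+-mono-≤ p q) r

  codegree-≤ : (i ∸ i₁) ℕ.+ (j ∸ j₁) ℕ.+ (m ∸ m₁) ≤ i ℕ.+ j ℕ.+ m
  codegree-≤ = ℕP.+-mono-≤ (ℕP.+-mono-≤ (ℕP.m∸n≤m i i₁) (ℕP.m∸n≤m j j₁)) (ℕP.m∸n≤m m m₁)

  degree-split : i₁ ≤ i → j₁ ≤ j → m₁ ≤ m →
    ((i ∸ i₁) ℕ.+ (j ∸ j₁) ℕ.+ (m ∸ m₁)) ℕ.+ (i₁ ℕ.+ j₁ ℕ.+ m₁) ≡ i ℕ.+ j ℕ.+ m
  degree-split p q r = ≡.trans
    (NS.solve 6 (λ a b c x y z → (a NS.:+ b NS.:+ c) NS.:+ (x NS.:+ y NS.:+ z)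
                          NS.:= (a NS.:+ x) NS.:+ (b NS.:+ y) NS.:+ (c NS.:+ z))
       ≡.refl (i ∸ i₁) (j ∸ j₁) (m ∸ m₁) i₁ j₁ m₁)
    (≡.cong₂ ℕ._+_ (≡.cong₂ ℕ._+_ (ℕP.m∸n+n≡m p) (ℕP.m∸n+n≡m q)) (ℕP.m∸n+n≡m r))

*F-cong : ∀ {d f f′ g g′} → f ≃[ d ] f′ → g ≃[ d ] g′ → f *F g ≃[ d ] f′ *F g′
*F-cong f≃f′ g≃g′ = agree λ i j m l → boxSum-cong i j m λ i₁ j₁ m₁ p q r →
  ≡.cong₂ ℤ._*_ (coeff f≃f′ i₁ j₁ m₁ (ℕP.≤-<-trans (degree-≤ p q r) l))
                (coeff g≃g′ (i ∸ i₁) (j ∸ j₁) (m ∸ m₁) (ℕP.≤-<-trans (codegree-≤ {i₁ = i₁} {j₁} {m₁}) l))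

-- Orders add under multiplication: in each term of the Cauchy product
-- either the first factor has degree < d or the second has degree < e.
ord-* : ∀ {d e f g} → Ord d f → Ord e g → Ord (d ℕ.+ e) (f *F g)
ord-* {d} {e} {f} {g} f≃0 g≃0 = agree λ i j m l → boxSum-zero i j m (term-zero l)
  where
  term-zero : ∀ {i j m} → i ℕ.+ j ℕ.+ m < d ℕ.+ e → ∀ i₁ j₁ m₁ → i₁ ≤ i → j₁ ≤ j → m₁ ≤ m →
              f i₁ j₁ m₁ ℤ.* g (i ∸ i₁) (j ∸ j₁) (m ∸ m₁) ≡ ℤ.0ℤ
  term-zero {i} {j} {m} l i₁ j₁ m₁ p q r with i₁ ℕ.+ j₁ ℕ.+ m₁ ℕ.<? d
  ... | yes small = ≡.trans (≡.cong (ℤ._* g (i ∸ i₁) (j ∸ j₁) (m ∸ m₁)) (coeff f≃0 i₁ j₁ m₁ small))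
                             (ℤP.*-zeroˡ (g (i ∸ i₁) (j ∸ j₁) (m ∸ m₁)))
  ... | no large  = ≡.trans (≡.cong (f i₁ j₁ m₁ ℤ.*_) (coeff g≃0 (i ∸ i₁) (j ∸ j₁) (m ∸ m₁) small′))
                             (ℤP.*-zeroʳ (f i₁ j₁ m₁))
    where
    small′ : (i ∸ i₁) ℕ.+ (j ∸ j₁) ℕ.+ (m ∸ m₁) < e
    small′ = ℕP.+-cancelʳ-< d _ e (ℕP.≤-<-trans (ℕP.+-monoʳ-≤ _ (ℕP.≮⇒≥ large))
               (≡.subst (_< e ℕ.+ d) (≡.sym (degree-split p q r))
                        (≡.subst (i ℕ.+ j ℕ.+ m <_) (ℕP.+-comm d e) l)))

ord-*ˡ : ∀ {d f} g → Ord d f → Ord d (f *F g)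
ord-*ˡ {d} g f≃0 = ≃-weaken (ℕP.≤-reflexive (≡.sym (ℕP.+-identityʳ d))) (ord-* {e = 0} {g = g} f≃0 ord-zero)

ord-*ʳ : ∀ {d g} f → Ord d g → Ord d (f *F g)
ord-*ʳ f g≃0 = ord-* {d = 0} {f = f} ord-zero g≃0

negF : FPS → FPS
negF f i j m = ℤ.- f i j m

Trunc : ℕ → CommutativeRing 0ℓ 0ℓ
Trunc d = record
  { Carrier = FPS ; _≈_ = _≃[ d ]_ ; _+_ = _+F_ ; _*_ = _*F_ ; -_ = negF ; 0# = 0F ; 1# = 1F
  ; isCommutativeRing = record
    { isRing = record
      { +-isAbelianGroup = record
        { isGroup = record
          { isMonoid = record
            { isSemigroup = record
              { isMagma = record
                { isEquivalence = record { refl = ≃-refl ; sym = ≃-sym ; trans = ≃-trans }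
                ; ∙-cong = λ p q → agree (λ i j m l → ≡.cong₂ ℤ._+_ (coeff p i j m l) (coeff q i j m l)) }
              ; assoc = λ f g h → exact (λ i j m → ℤP.+-assoc (f i j m) (g i j m) (h i j m)) }
            ; identity = (λ f → exact (λ i j m → ℤP.+-identityˡ (f i j m)))
                       , (λ f → exact (λ i j m → ℤP.+-identityʳ (f i j m))) }
          ; inverse = (λ f → exact (λ i j m → ℤP.+-inverseˡ (f i j m)))
                    , (λ f → exact (λ i j m → ℤP.+-inverseʳ (f i j m)))
          ; ⁻¹-cong = λ p → agree (λ i j m l → ≡.cong ℤ.-_ (coeff p i j m l)) }
        ; comm = λ f g → exact (λ i j m → ℤP.+-comm (f i j m) (g i j m)) }
      ; *-cong = *F-cong
      ; *-assoc = λ f g h → exact (*F-assoc f g h)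
      ; *-identity = (λ f → exact (*F-identityˡ f))
                   , (λ f → exact (≐-trans (*F-comm f 1F) (*F-identityˡ f)))
      ; distrib = (λ f g h → exact (*F-distribˡ f g h))
                , (λ h f g → exact (≐-trans (*F-comm (f +F g) h) (≐-trans (*F-distribˡ h f g)
                     (λ i j m → ≡.cong₂ ℤ._+_ (*F-comm h f i j m) (*F-comm h g i j m))))) }
    ; *-comm = λ f g → exact (*F-comm f g) } }

ord-pow : ∀ {x} n → Ord 1 x → Ord n (x ^F n)
ord-pow zero    x≃0 = ord-zero
ord-pow (suc n) x≃0 =
  ≃-weaken (ℕP.≤-reflexive (ℕP.+-comm 1 n)) (ord-* (ord-pow n x≃0) x≃0)

InfSum-approx : ∀ (f : ℕ → FPS) → (∀ k → Ord k (f k)) → ∀ {d} M → d ≤ M → InfSum f ≃[ d ] sumN M f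
InfSum-approx f ord-f M d≤M = agree λ i j m l → ≡.sym (stable i j m M (ℕP.≤-trans l d≤M))
  where
  stable : ∀ i j m M → suc (i ℕ.+ j ℕ.+ m) ≤ M → sumN M f i j m ≡ sumN (suc (i ℕ.+ j ℕ.+ m)) f i j m
  stable i j m (suc M) l with ℕP.m≤n⇒m<n∨m≡n l
  ... | inj₂ N≡M = ≡.cong (λ z → sumN z f i j m) (≡.sym N≡M)
  ... | inj₁ N<M = ≡.trans (≡.cong₂ ℤ._+_ (stable i j m M (ℕP.≤-pred N<M)) (coeff (ord-f M) i j m (ℕP.≤-pred N<M)))
                           (ℤP.+-identityʳ _)

InfProd-approx : ∀ (f : ℕ → FPS) → (∀ k → f k ≃[ suc k ] 1F) → ∀ {d} M → d ≤ M → InfProd f ≃[ d ] prodN M f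
InfProd-approx f f≃1 M d≤M = agree λ i j m l → ≡.sym (stable i j m M (ℕP.≤-trans l d≤M))
  where
  stable : ∀ i j m M → suc (i ℕ.+ j ℕ.+ m) ≤ M → prodN M f i j m ≡ prodN (suc (i ℕ.+ j ℕ.+ m)) f i j m
  stable i j m (suc M) l with ℕP.m≤n⇒m<n∨m≡n l
  ... | inj₂ N≡M = ≡.cong (λ z → prodN z f i j m) (≡.sym N≡M)
  ... | inj₁ N<M = ≡.trans (coeff (*F-cong {f = prodN M f} ≃-refl (f≃1 M)) i j m (ℕP.<⇒≤ N<M))
                   (≡.trans (*F-comm (prodN M f) 1F i j m)
                   (≡.trans (*F-identityˡ (prodN M f) i j m) (stable i j m M (ℕP.≤-pred N<M))))

InfProd-one : ∀ {d} (f : ℕ → FPS) → (∀ k → f k ≃[ d ] 1F) → InfProd f ≃[ d ] 1F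
InfProd-one {d} f f≃1 = agree λ i j m l → coeff (prod-one (suc (i ℕ.+ j ℕ.+ m))) i j m l
  where
  prod-one : ∀ n → prodN n f ≃[ d ] 1F
  prod-one zero    = ≃-refl
  prod-one (suc n) = ≃-trans (*F-cong (prod-one n) (f≃1 n)) (exact (*F-identityˡ 1F))


module Modulo (d : ℕ) where
  open CommutativeRing (Trunc d) public
  open IntegerSolver (Trunc d) public using (solve; _:=_; _:+_; _:*_; _:-_; con)
  open FiniteSums (Trunc d) public
  open import Relation.Binary.Reasoning.Setoid setoid public

  one : ∀ {n} → IntegerSolver.Polynomial (Trunc d) n
  one = con (+ 1)

  sumN≡sumR : ∀ n f → sumN n f ≡ sumR n f
  sumN≡sumR zero    f = ≡.refl
  sumN≡sumR (suc n) f = ≡.cong (_+F f n) (sumN≡sumR n f)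

  InfSum≈ : ∀ (f : ℕ → FPS) → (∀ k → Ord k (f k)) → ∀ M → d ≤ M → InfSum f ≈ sumR M f
  InfSum≈ f ord-f M d≤M = trans (InfSum-approx f ord-f M d≤M) (reflexive (sumN≡sumR M f))

  pow-cong : ∀ {x y} n → x ≈ y → x ^F n ≈ y ^F n
  pow-cong zero    x≈y = refl
  pow-cong (suc n) x≈y = *-cong (pow-cong n x≈y) x≈y

  pow-+ : ∀ x m n → x ^F (m ℕ.+ n) ≈ x ^F m * x ^F n
  pow-+ x zero    n = sym (*-identityˡ (x ^F n))
  pow-+ x (suc m) n = trans (*-congʳ {x} (pow-+ x m n))
    (solve 3 (λ a b x → (a :* b) :* x := (a :* x) :* b) refl (x ^F m) (x ^F n) x)

  prod-cong : ∀ n {f g : ℕ → FPS} → (∀ k → f k ≈ g k) → prodN n f ≈ prodN n g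
  prod-cong zero    f≈g = refl
  prod-cong (suc n) f≈g = *-cong (prod-cong n f≈g) (f≈g n)

  prod-peel : ∀ n (f : ℕ → FPS) → prodN (suc n) f ≈ f 0 * prodN n (f ∘ suc)
  prod-peel zero    f = *-comm 1F (f 0)
  prod-peel (suc n) f =
    trans (*-congʳ {f (suc n)} (prod-peel n f)) (*-assoc (f 0) (prodN n (f ∘ suc)) (f (suc n)))

  geometric-sum : ∀ n x → sumR n (x ^F_) * (1F - x) ≈ 1F - x ^F n
  geometric-sum zero    x = solve 1 (λ x → con (+ 0) :* (one :- x) := one :- one) refl x
  geometric-sum (suc n) x = begin
    (S + x ^F n) * (1F - x)             ≈⟨ distribʳ (1F - x) S (x ^F n) ⟩
    S * (1F - x) + x ^F n * (1F - x)    ≈⟨ +-congʳ {x ^F n * (1F - x)} (geometric-sum n x) ⟩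
    (1F - x ^F n) + x ^F n * (1F - x)   ≈⟨ solve 2 (λ p x → (one :- p) :+ p :* (one :- x) := one :- p :* x)
                                             refl (x ^F n) x ⟩
    1F - x ^F suc n                     ∎
    where S = sumR n (x ^F_)

  geom-inverse : ∀ {x} → Ord 1 x → geom x * (1F - x) ≈ 1F
  geom-inverse {x} x≃0 = begin
    geom x * (1F - x)           ≈⟨ *-congʳ {1F - x} (InfSum≈ (x ^F_) (λ k → ord-pow k x≃0) d ℕP.≤-refl) ⟩
    sumR d (x ^F_) * (1F - x)   ≈⟨ geometric-sum d x ⟩
    1F - x ^F d                 ≈⟨ +-congˡ {1F} (-‿cong (ord-pow d x≃0)) ⟩
    1F - 0F                     ≈⟨ solve 0 (one :- con (+ 0) := one) refl ⟩
    1F                          ∎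

  geom-≈1 : ∀ {x} → Ord 1 x → Ord d x → geom x ≈ 1F
  geom-≈1 {x} x≃0 x≈0 = begin
    geom x                            ≈⟨ solve 2 (λ g x → g := g :* (one :- x) :+ x :* g) refl (geom x) x ⟩
    geom x * (1F - x) + x * geom x    ≈⟨ +-cong (geom-inverse x≃0) (ord-*ˡ (geom x) x≈0) ⟩
    1F + 0F                           ≈⟨ +-identityʳ 1F ⟩
    1F                                ∎

  geom-cong : ∀ {x y} → x ≈ y → geom x ≈ geom y
  geom-cong {x} {y} x≈y = agree λ i j m l → coeff (partial-sums (suc (i ℕ.+ j ℕ.+ m))) i j m l
    where
    partial-sums : ∀ n → sumN n (x ^F_) ≈ sumN n (y ^F_)
    partial-sums zero    = refl
    partial-sums (suc n) = +-cong (partial-sums n) (pow-cong n x≈y)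

ord-mono : ∀ i j m → Ord (i ℕ.+ j ℕ.+ m) (mono i j m)
ord-mono i j m = agree λ i′ j′ m′ l → vanish i′ j′ m′ l
  where
  vanish : ∀ i′ j′ m′ → i′ ℕ.+ j′ ℕ.+ m′ < i ℕ.+ j ℕ.+ m → mono i j m i′ j′ m′ ≡ ℤ.0ℤ
  vanish i′ j′ m′ l with i ℕ.≡ᵇ i′ in eqi | j ℕ.≡ᵇ j′ in eqj | m ℕ.≡ᵇ m′ in eqm
  ... | false | _     | _     = ≡.refl
  ... | true  | false | _     = ≡.refl
  ... | true  | true  | false = ≡.refl
  ... | true  | true  | true  = ⊥-elim (ℕP.<-irrefl same-degree l)
    where
    same : ∀ x y → (x ℕ.≡ᵇ y) ≡ true → y ≡ x
    same x y eq = ≡.sym (ℕP.≡ᵇ⇒≡ x y (≡.subst T (≡.sym eq) tt))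
    same-degree : i′ ℕ.+ j′ ℕ.+ m′ ≡ i ℕ.+ j ℕ.+ m
    same-degree = ≡.cong₂ ℕ._+_ (≡.cong₂ ℕ._+_ (same i i′ eqi) (same j j′ eqj)) (same m m′ eqm)

ord-a : Ord 1 aF
ord-a = ord-mono 1 0 0

ord-c : Ord 1 cF
ord-c = ord-mono 0 1 0

ord-q : Ord 1 qF
ord-q = ord-mono 0 0 1

geomFactor : ℕ → FPS
geomFactor k = geom (aF *F qF ^F k)

-- D n = 1/((1−a)(1−aq)⋯(1−aq^(n−1))); D 0 = 1 and Den n = D (n + 1).
D : ℕ → FPS
D n = prodN n geomFactor

D∞ : FPS
D∞ = InfProd geomFactor

P-factor : ℕ → ℕ → FPS
P-factor s k = 1F +F aF *F cF *F qF ^F (s ℕ.+ k)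

Q : ℕ → FPS
Q k = qF ^F (suc k C 2) *F cF ^F k

ord-aqᵏ : ∀ k → Ord (suc k) (aF *F qF ^F k)
ord-aqᵏ k = ord-* ord-a (ord-pow k ord-q)

ord-Q : ∀ k → Ord k (Q k)
ord-Q k = ord-*ʳ (qF ^F (suc k C 2)) (ord-pow k ord-c)

geomFactor≈1 : ∀ k → geomFactor k ≃[ suc k ] 1F
geomFactor≈1 k = Modulo.geom-≈1 (suc k) (≃-weaken (s≤s z≤n) (ord-aqᵏ k)) (ord-aqᵏ k)

P-factor≈1 : ∀ s k e → e ≤ suc (suc (s ℕ.+ k)) → P-factor s k ≃[ e ] 1F
P-factor≈1 s k e e≤ = agree λ i j m l →
  ≡.trans (≡.cong (λ z → 1F i j m ℤ.+ z) (coeff acqˢ⁺ᵏ≃0 i j m (ℕP.<-≤-trans l e≤))) (ℤP.+-identityʳ _)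
  where
  acqˢ⁺ᵏ≃0 : Ord (suc (suc (s ℕ.+ k))) (aF *F cF *F qF ^F (s ℕ.+ k))
  acqˢ⁺ᵏ≃0 = ord-* (ord-* ord-a ord-c) (ord-pow (s ℕ.+ k) ord-q)

D∞-approx : ∀ {e} n → e ≤ n → D∞ ≃[ e ] D n
D∞-approx n e≤n = InfProd-approx geomFactor geomFactor≈1 n e≤n

P-approx : ∀ s {e} n → e ≤ n → P s ≃[ e ] prodN n (P-factor s)
P-approx s n e≤n = InfProd-approx (P-factor s)
  (λ k → P-factor≈1 s k (suc k) (s≤s (ℕP.≤-trans (ℕP.m≤n+m k s) (ℕP.n≤1+n _)))) n e≤n

P≈1 : ∀ s e → e ≤ suc (suc s) → P s ≃[ e ] 1F
P≈1 s e e≤ = InfProd-one (P-factor s) (λ k → P-factor≈1 s k e (ℕP.≤-trans e≤ (s≤s (s≤s (ℕP.m≤m+n s k)))))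

ord-T₁ : ∀ k → Ord k (T₁ (suc k))
ord-T₁ k = ord-*ˡ (Den (suc k)) (ord-*ˡ (P (suc (suc k)))
             (≃-weaken (ℕP.≤-trans (ℕP.n≤1+n k) (ℕP.n≤1+n (suc k))) (ord-aqᵏ (suc k))))

ord-T₂ : ∀ k → Ord k (T₂ (suc k))
ord-T₂ k = ord-*ˡ (P (suc (suc k))) (≃-weaken (ℕP.n≤1+n k) (ord-Q (suc k)))

C2-suc : ∀ k → suc k C 2 ≡ k ℕ.+ k C 2
C2-suc k = ≡.trans (≡.sym (NC.nCk+nC[k+1]≡[n+1]C[k+1] k 1)) (≡.cong (ℕ._+ k C 2) (NC.nC1≡n k))

-- The exponent of q in c q^s · q^(k choose 2 + k(s+1)).
exponent-step : ∀ k s → s ℕ.+ (k C 2 ℕ.+ k ℕ.* suc s) ≡ suc k C 2 ℕ.+ suc k ℕ.* s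
exponent-step k s = ≡.trans
  (NS.solve 3 (λ s c k → s NS.:+ (c NS.:+ k NS.:* (NS.con 1 NS.:+ s)) NS.:= (k NS.:+ c) NS.:+ (NS.con 1 NS.:+ k) NS.:* s)
     ≡.refl s (k C 2) k)
  (≡.cong (ℕ._+ suc k ℕ.* s) (≡.sym (C2-suc k)))
  where module NS = Data.Nat.Solver.+-*-Solver

-- The argument, carried out modulo degree d, where N = d + 1 terms of each
-- infinite sum or product already give the truncated value.
module Main (d : ℕ) where
  open Modulo d
  open Telescoping (Trunc d) using (weight; unroll)

  N : ℕ
  N = suc d

  d≤N : d ≤ N
  d≤N = ℕP.n≤1+n d

  P-step : ∀ s → P s ≈ P (suc s) + aF * cF * qF ^F s * P (suc s)
  P-step s = begin
    P s                                         ≈⟨ P-approx s N d≤N ⟩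
    prodN N (P-factor s)                        ≈⟨ prod-peel d (P-factor s) ⟩
    P-factor s 0 * prodN d (P-factor s ∘ suc)   ≈⟨ *-cong (reflexive (≡.cong factor (ℕP.+-identityʳ s)))
                                                          (prod-cong d (λ k → reflexive (≡.cong factor (ℕP.+-suc s k)))) ⟩
    (1F + X) * prodN d (P-factor (suc s))       ≈⟨ *-congˡ {1F + X} (≃-sym (P-approx (suc s) d ℕP.≤-refl)) ⟩
    (1F + X) * P (suc s)                        ≈⟨ solve 2 (λ x p → (one :+ x) :* p := p :+ x :* p) refl X (P (suc s)) ⟩
    P (suc s) + X * P (suc s)                   ∎
    where
    X = aF * cF * qF ^F s
    factor : ℕ → FPS
    factor e = 1F +F aF *F cF *F qF ^F e

  -- a q^n D (n+1) = D (n+1) − D n, since D (n+1) = D n / (1 − a q^n).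
  D-step : ∀ n → aF * qF ^F n * D (suc n) ≈ D (suc n) - D n
  D-step n = begin
    x * (D n * g)                         ≈⟨ solve 3 (λ x p g → x :* (p :* g) := p :* g :- p :* (g :* (one :- x)))
                                               refl x (D n) g ⟩
    D n * g + - (D n * (g * (1F - x)))    ≈⟨ +-congˡ {D n * g} (-‿cong (*-congˡ {D n}
                                               (geom-inverse (≃-weaken (s≤s z≤n) (ord-aqᵏ n))))) ⟩
    D n * g + - (D n * 1F)                ≈⟨ +-congˡ {D n * g} (-‿cong (*-identityʳ (D n))) ⟩
    D (suc n) - D n                       ∎
    where
    x = aF * qF ^F n
    g = geomFactor n

  open Telescoping.Recurrence (Trunc d) aF cF (qF ^F_) P D (pow-+ qF) P-step D-step

  weight-closed : ∀ k s → weight u k s ≈ qF ^F (k C 2 ℕ.+ k ℕ.* s) * cF ^F k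
  weight-closed zero    s = sym (*-identityʳ 1F)
  weight-closed (suc k) s = begin
    (cF * qF ^F s) * weight u k (suc s)               ≈⟨ *-congˡ {cF * qF ^F s} (weight-closed k (suc s)) ⟩
    (cF * qF ^F s) * (qF ^F e * cF ^F k)              ≈⟨ solve 4 (λ c x y z → (c :* x) :* (y :* z) := (x :* y) :* (z :* c))
                                                           refl cF (qF ^F s) (qF ^F e) (cF ^F k) ⟩
    (qF ^F s * qF ^F e) * cF ^F suc k                 ≈⟨ *-congʳ {cF ^F suc k} (sym (pow-+ qF s e)) ⟩
    qF ^F (s ℕ.+ e) * cF ^F suc k                     ≡⟨ ≡.cong (λ t → qF ^F t * cF ^F suc k) (exponent-step k s) ⟩
    qF ^F (suc k C 2 ℕ.+ suc k ℕ.* s) * cF ^F suc k   ∎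
    where e = k C 2 ℕ.+ k ℕ.* suc s

  weight≈Q : ∀ k → weight u k 1 ≈ Q k
  weight≈Q k = trans (weight-closed k 1) (reflexive (≡.cong (λ t → qF ^F t * cF ^F k) exponent))
    where
    exponent : k C 2 ℕ.+ k ℕ.* 1 ≡ suc k C 2
    exponent = ≡.trans (≡.cong (k C 2 ℕ.+_) (ℕP.*-identityʳ k))
                       (≡.trans (ℕP.+-comm (k C 2) k) (≡.sym (C2-suc k)))

  A-stabilised : ∀ s → A N s ≈ D∞ - P s
  A-stabilised s = begin
    D N * P (s ℕ.+ N) - 1F * P s   ≈⟨ +-cong (*-cong (≃-sym (D∞-approx N d≤N)) (P≈1 (s ℕ.+ N) d (ℕP.≤-trans d≤N big)))
                                             (-‿cong (*-identityˡ (P s))) ⟩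
    D∞ * 1F - P s                  ≈⟨ +-congʳ {negF (P s)} (*-identityʳ D∞) ⟩
    D∞ - P s                       ∎
    where
    big : N ≤ suc (suc (s ℕ.+ N))
    big = ℕP.≤-trans (ℕP.m≤n+m N s) (ℕP.≤-trans (ℕP.n≤1+n _) (ℕP.n≤1+n _))

  T₁≈term : ∀ n → T₁ n ≈ term 1 n
  T₁≈term n = *-cong {aF *F qF ^F n *F P (suc n)} {aF *F qF ^F n *F P (1 ℕ.+ n)} {Den n} {D (suc n)} refl refl

  -- Σ_{n<N} T₁ n = Σ_{k<N} Q k (D∞ − P (k+1)); the remainder term of the
  -- unrolled recurrence carries the factor Q N, which vanishes modulo d.
  T₁-sum : sumR N T₁ ≈ sumR N (λ k → Q k * (D∞ - P (1 ℕ.+ k)))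
  T₁-sum = begin
    sumR N T₁
      ≈⟨ sum-cong N T₁≈term ⟩
    K N 1
      ≈⟨ K-unrolled N N 1 ⟩
    sumR N (λ k → weight u k 1 * A N (1 ℕ.+ k)) + weight u N 1 * K N (1 ℕ.+ N)
      ≈⟨ +-cong (sum-cong N (λ k → *-cong (weight≈Q k) (A-stabilised (1 ℕ.+ k))))
                (ord-*ˡ (K N (1 ℕ.+ N)) negligible) ⟩
    S + 0F
      ≈⟨ +-identityʳ S ⟩
    S ∎
    where
    S = sumR N (λ k → Q k * (D∞ - P (1 ℕ.+ k)))
    negligible : Ord d (weight u N 1)
    negligible = trans (weight≈Q N) (≃-weaken d≤N (ord-Q N))

  LHS-head : geom aF *F P 1 ≈ T₂ 0 + T₁ 0
  LHS-head = begin
    geom aF * P 1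
      ≈⟨ *-cong geom-a≈D₁ (refl {P 1}) ⟩
    D₁ * P₁
      ≈⟨ solve 2 (λ δ p → δ :* p := (one :* one) :* p :+ (δ :- one) :* p) refl D₁ P₁ ⟩
    (1F * 1F) * P₁ + (D₁ - D 0) * P₁
      ≈⟨ +-congˡ {(1F * 1F) * P₁} (*-congʳ {P₁} (sym (D-step 0))) ⟩
    (1F * 1F) * P₁ + (aF * qF ^F 0 * D₁) * P₁
      ≈⟨ +-congˡ {(1F * 1F) * P₁} (solve 3 (λ x δ p → (x :* δ) :* p := x :* p :* δ) refl (aF * qF ^F 0) D₁ P₁) ⟩
    (1F * 1F) * P₁ + aF * qF ^F 0 * P₁ * D₁
      ≈⟨ +-cong T₂-zero refl ⟩
    T₂ 0 + T₁ 0 ∎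
    where
    P₁ = P (suc 0)
    D₁ = D (suc 0)
    geom-a≈D₁ : geom aF ≈ D₁
    geom-a≈D₁ = trans (geom-cong (sym (*-identityʳ aF))) (sym (*-identityˡ (geomFactor 0)))
    T₂-zero : (1F * 1F) * P₁ ≈ T₂ 0
    T₂-zero = *-cong {1F * 1F} {qF ^F (1 C 2) *F cF ^F 0} {P₁} {P₁} refl refl

  LHS-truncated : LHS ≈ sumR N T₁ + sumR N T₂
  LHS-truncated = begin
    LHS
      ≈⟨ +-cong (+-cong LHS-head (InfSum≈ (λ n → T₁ (suc n)) ord-T₁ d ℕP.≤-refl))
                (InfSum≈ (λ n → T₂ (suc n)) ord-T₂ d ℕP.≤-refl) ⟩
    (T₂ 0 + T₁ 0) + sumR d (T₁ ∘ suc) + sumR d (T₂ ∘ suc)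
      ≈⟨ solve 4 (λ t₂ t₁ σ₁ σ₂ → (t₂ :+ t₁) :+ σ₁ :+ σ₂ := (t₁ :+ σ₁) :+ (t₂ :+ σ₂))
           refl (T₂ 0) (T₁ 0) (sumR d (T₁ ∘ suc)) (sumR d (T₂ ∘ suc)) ⟩
    (T₁ 0 + sumR d (T₁ ∘ suc)) + (T₂ 0 + sumR d (T₂ ∘ suc))
      ≈⟨ +-cong (sym (sum-peel d T₁)) (sym (sum-peel d T₂)) ⟩
    sumR N T₁ + sumR N T₂ ∎

  recombine : sumR N (λ k → Q k * (D∞ - P (1 ℕ.+ k))) + sumR N T₂ ≈ sumR N Q * D∞
  recombine = begin
    sumR N (λ k → Q k * (D∞ - P (1 ℕ.+ k))) + sumR N T₂
      ≈⟨ sym (sum-+ N (λ k → Q k * (D∞ - P (1 ℕ.+ k))) T₂) ⟩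
    sumR N (λ k → Q k * (D∞ - P (1 ℕ.+ k)) + T₂ k)
      ≈⟨ sum-cong N (λ k → solve 3 (λ q δ p → q :* (δ :- p) :+ q :* p := δ :* q) refl (Q k) D∞ (P (suc k))) ⟩
    sumR N (λ k → D∞ * Q k)                     ≈⟨ sum-*ˡ N D∞ Q ⟩
    D∞ * sumR N Q                               ≈⟨ *-comm D∞ (sumR N Q) ⟩
    sumR N Q * D∞                               ∎

  LHS≈RHS : LHS ≈ RHS
  LHS≈RHS = begin
    LHS                                                   ≈⟨ LHS-truncated ⟩
    sumR N T₁ + sumR N T₂                                 ≈⟨ +-congʳ {sumR N T₂} T₁-sum ⟩
    sumR N (λ k → Q k * (D∞ - P (1 ℕ.+ k))) + sumR N T₂   ≈⟨ recombine ⟩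
    sumR N Q * D∞                                         ≈⟨ *-congʳ {D∞} (sym (InfSum≈ Q ord-Q N d≤N)) ⟩
    RHS                                                   ∎

-- The coefficient of a^i c^j q^m is seen modulo degree i + j + m + 1.
mainTheorem1 : ∀ (i j m : ℕ) → LHS i j m ≡ RHS i j m
mainTheorem1 i j m = coeff (Main.LHS≈RHS (suc (i ℕ.+ j ℕ.+ m))) i j m ℕP.≤-refl
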